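{- Let $h_1,h_2,\dots$, $H_1,H_2,\dots$ and $G_1,G_2,\dots$ be elements of a commutative ring. For $s\ge1$ let $\Delta_s({\bf h})$, $\Psi_s({\bf h},{\bf H})$, $\Lambda_s({\bf h},{\bf H},{\bf G})$ be the MCL determinants defined in the context, and set $\Delta_0({\bf h})=\Psi_0({\bf h},{\bf H})=\Lambda_0({\bf h},{\bf H},{\bf G})=1$. Then for every $s\ge1$: \[\Delta_s({\bf h})=-\sum_{k=0}^{s-1}h_{s-k}\Delta_k({\bf h}),\qquad \Psi_s({\bf h},{\bf H})=-\sum_{k=0}^{s-1}H_{s-k}\Delta_k({\bf h}),\] \[\Psi_s({\bf h},{\bf H})=-H_s-\sum_{k=1}^{s-1}h_{s-k}\Psi_k({\bf h},{\bf H}),\qquad \Lambda_s({\bf h},{\bf H},{\bf G})=-\sum_{k=0}^{s-1}H_{s-k}\Psi_k({\bf h},{\bf G}).\] Conversely, if quantities $D_0=1,D_1,\dots,D_s$ satisfy $D_m=-\sum_{k=0}^{m-1}h_{m-k}D_k$ for $1\le m\le s$, then $D_m=\Delta_m({\bf h})$ for all $m\le s$; if $P_0=1,P_1,\dots,P_s$ satisfy either $P_m=-\sum_{k=0}^{m-1}H_{m-k}\Delta_k({\bf h})$ for $1\le m\le s$ or $P_m=-H_m-\sum_{k=1}^{m-1}h_{m-k}P_k$ for $1\le m\le s$ (each of these implies the other), then $P_m=\Psi_m({\bf h},{\bf H})$ for $m\le s$; and if in addition $L_m=-\sum_{k=0}^{m-1}H_{m-k}\Psi_k({\bf h},{\bf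 G})$ for $1\le m\le s$, then $L_m=\Lambda_m({\bf h},{\bf H},{\bf G})$ for $m\le s$.
   Context: For $s\ge1$: $\Delta_s({\bf h})=(-1)^s\det(a_{ij})_{1\le i,j\le s}$ with $a_{ij}=h_{i-j+1}$ if $j\le i$, $a_{ij}=1$ if $j=i+1$, $a_{ij}=0$ if $j>i+1$ (type 1 MCL determinant). $\Psi_s({\bf h},{\bf H})=(-1)^s\det(b_{ij})$ with $b_{i1}=H_i$ and $b_{ij}=a_{ij}$ for $j\ge2$ (half-weighted, type 2). $\Lambda_s({\bf h},{\bf H},{\bf G})=(-1)^s\det(c_{ij})$ with $c_{i1}=H_i$ for all $i$, $c_{sj}=G_{s-j+1}$ for $2\le j\le s$, and $c_{ij}=a_{ij}$ for $i<s$, $j\ge2$ (fully-weighted, type 3); for $s=1$ this is $-H_1$. -}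

module Defs where

open import Level using (Level)
open import Algebra.Bundles using (CommutativeRing)
open import Data.Nat using (ℕ; zero; suc; _∸_; _≤?_; _≟_)
open import Data.Fin using (Fin; toℕ; punchIn) renaming (zero to fzero; suc to fsuc)
open import Relation.Nullary using (yes; no)

module MCL {c ℓ : Level} (R : CommutativeRing c ℓ) where
  open CommutativeRing R

  Matrix : ℕ → Set c
  Matrix n = Fin n → Fin n → Carrier

  negPow : ℕ → Carrier → Carrier
  negPow zero x = x
  negPow (suc k) x = - negPow k x

  sumFin : (n : ℕ) → (Fin n → Carrier) → Carrier
  sumFin zero f = 0#
  sumFin (suc n) f = f fzero + sumFin n (λ j → f (fsuc j))

  sumTo : ℕ → (ℕ → Carrier) → Carrier
  sumTo zero f = 0#
  sumTo (suc n) f = sumTo n f + f n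

  minor : ∀ {n} → Matrix (suc n) → Fin (suc n) → Matrix n
  minor M j i k = M (fsuc i) (punchIn j k)

  det : (n : ℕ) → Matrix n → Carrier
  det zero M = 1#
  det (suc n) M =
    sumFin (suc n) (λ j → negPow (toℕ j) (M fzero j * det n (minor M j)))

  -- entry a_{ij} of the type-1 MCL matrix, with 0-based indices i' = i-1, j' = j-1:
  -- h_{i-j+1} if j ≤ i, 1 if j = i+1, 0 if j > i+1.
  -- Sequences are ℕ → Carrier with h_k read as h k (h 0 unused).
  aEntry : (ℕ → Carrier) → ℕ → ℕ → Carrier
  aEntry h i j with j ≤? i
  ... | yes _ = h (suc (i ∸ j))
  ... | no _ with j ≟ suc i
  ...   | yes _ = 1#
  ...   | no _ = 0#

  ΔMat : (ℕ → Carrier) → (s : ℕ) → Matrix s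
  ΔMat h s i j = aEntry h (toℕ i) (toℕ j)

  ΨMat : (ℕ → Carrier) → (ℕ → Carrier) → (s : ℕ) → Matrix s
  ΨMat h H s i fzero = H (suc (toℕ i))
  ΨMat h H s i (fsuc j) = aEntry h (toℕ i) (suc (toℕ j))

  -- first column H_i; last row (i = s) has G_{s-j+1} in columns 2..s; else a_{ij}
  ΛMat : (ℕ → Carrier) → (ℕ → Carrier) → (ℕ → Carrier) → (s : ℕ) → Matrix s
  ΛMat h H G s i fzero = H (suc (toℕ i))
  ΛMat h H G s i (fsuc j) with suc (toℕ i) ≟ s
  ... | yes _ = G (s ∸ suc (toℕ j))
  ... | no _ = aEntry h (toℕ i) (suc (toℕ j))

  Δ : (ℕ → Carrier) → ℕ → Carrier
  Δ h s = negPow s (det s (ΔMat h s))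

  Ψ : (ℕ → Carrier) → (ℕ → Carrier) → ℕ → Carrier
  Ψ h H s = negPow s (det s (ΨMat h H s))

  Λ : (ℕ → Carrier) → (ℕ → Carrier) → (ℕ → Carrier) → ℕ → Carrier
  Λ h H G s = negPow s (det s (ΛMat h H G s))

-- All three matrices are lower Hessenberg with unit superdiagonal: the
-- entries (i, i+1) are 1 and everything further right is 0.  Expanding the
-- determinant of such a matrix f along its first row only meets f 0 0 and
-- the unit at (0,1); iterating on the second minor gives the first-column
-- expansion
--     det_{n+1} f = Σ_{j ≤ n} (-1)^j f(j,0) · det_{n-j} (trailing block of f),
-- and after reindexing the signs this is exactly an MCL recursion
--     (-1)^{n+1} det_{n+1} f = - Σ_{k ≤ n} f(n-k,0) · (-1)^k det_k (block k).
-- The MCL entries are shift invariant, so for Ψ (and Δ = Ψ with H = h) the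
-- trailing blocks are Δ-matrices; for Λ they are the matrices Γ_k with G in
-- the last row, which satisfy the second Ψ-recursion and hence equal
-- Ψ_k(h,G).  The second Ψ-recursion itself follows from the first by
-- induction, shifting H.  The converse statements are uniqueness of
-- solutions of these recursions, by induction below a bound s.
module Submission where

open import Defs
open import Level using (Level)
open import Algebra.Bundles using (CommutativeRing)
open import Data.Nat using (ℕ; zero; suc; _∸_; _≤_; z≤n; s≤s)
open import Data.Product using (_×_; _,_)
import Data.Nat as N
import Data.Nat.Properties as NP
open import Data.Fin using (Fin; toℕ; punchIn) renaming (zero to fzero; suc to fsuc)
open import Data.Fin.Properties using (toℕ<n)
open import Relation.Binary.Definitions using (tri<; tri≈; tri>)
import Relation.Binary.PropositionalEquality as P
open import Relation.Nullary using (yes; no; ¬_)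
open import Data.Empty using (⊥-elim)
import Algebra.Properties.Ring as RingProperties
import Algebra.Properties.CommutativeSemigroup as CommutativeSemigroupProperties

module MCLRecursions {c ℓ : Level} (R : CommutativeRing c ℓ) where
  open CommutativeRing R
  open MCL R
  open RingProperties ring using (-‿distribʳ-*; -‿involutive; -0#≈0#; -‿+-comm)
  open CommutativeSemigroupProperties *-commutativeSemigroup using (x∙yz≈y∙xz)
  open import Relation.Binary.Reasoning.Setoid setoid

  ≡⇒≈ : ∀ {x y} → x P.≡ y → x ≈ y
  ≡⇒≈ P.refl = refl

  suc-∸ : ∀ {n k} → k N.≤ n → suc n ∸ k P.≡ suc (n ∸ k)
  suc-∸ k≤n = NP.+-∸-assoc 1 k≤n

  sumTo-cong : ∀ n {f g : ℕ → Carrier} → (∀ k → k N.< n → f k ≈ g k) → sumTo n f ≈ sumTo n g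
  sumTo-cong zero eq = refl
  sumTo-cong (suc n) eq = +-cong (sumTo-cong n (λ k k<n → eq k (NP.m<n⇒m<1+n k<n))) (eq n NP.≤-refl)

  sumTo-unfoldˡ : ∀ n (f : ℕ → Carrier) → sumTo (suc n) f ≈ f 0 + sumTo n (λ k → f (suc k))
  sumTo-unfoldˡ zero f = trans (+-identityˡ _) (sym (+-identityʳ _))
  sumTo-unfoldˡ (suc n) f = begin
    sumTo (suc n) f + f (suc n)                     ≈⟨ +-congʳ (sumTo-unfoldˡ n f) ⟩
    (f 0 + sumTo n (λ k → f (suc k))) + f (suc n)   ≈⟨ +-assoc _ _ _ ⟩
    f 0 + sumTo (suc n) (λ k → f (suc k))           ∎

  sumTo-reverse : ∀ n (g : ℕ → Carrier) → sumTo n g ≈ sumTo n (λ k → g (n ∸ suc k))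
  sumTo-reverse zero g = refl
  sumTo-reverse (suc n) g = begin
    sumTo n g + g n                         ≈⟨ +-comm _ _ ⟩
    g n + sumTo n g                         ≈⟨ +-congˡ (sumTo-reverse n g) ⟩
    g n + sumTo n (λ k → g (n ∸ suc k))     ≈⟨ sumTo-unfoldˡ n (λ k → g (n ∸ k)) ⟨
    sumTo (suc n) (λ k → g (n ∸ k))         ∎

  sumTo-neg : ∀ n (f : ℕ → Carrier) → sumTo n (λ k → - f k) ≈ - sumTo n f
  sumTo-neg zero f = sym -0#≈0#
  sumTo-neg (suc n) f = trans (+-congʳ (sumTo-neg n f)) (-‿+-comm _ _)

  sumTo-+ : ∀ n (f g : ℕ → Carrier) → sumTo n (λ k → f k + g k) ≈ sumTo n f + sumTo n g
  sumTo-+ zero f g = sym (+-identityˡ 0#)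
  sumTo-+ (suc n) f g = begin
    sumTo n (λ k → f k + g k) + (f n + g n)   ≈⟨ +-congʳ (sumTo-+ n f g) ⟩
    (sumTo n f + sumTo n g) + (f n + g n)     ≈⟨ +-assoc _ _ _ ⟩
    sumTo n f + (sumTo n g + (f n + g n))     ≈⟨ +-congˡ (+-assoc _ _ _) ⟨
    sumTo n f + ((sumTo n g + f n) + g n)     ≈⟨ +-congˡ (+-congʳ (+-comm _ _)) ⟩
    sumTo n f + ((f n + sumTo n g) + g n)     ≈⟨ +-congˡ (+-assoc _ _ _) ⟩
    sumTo n f + (f n + (sumTo n g + g n))     ≈⟨ +-assoc _ _ _ ⟨
    (sumTo n f + f n) + (sumTo n g + g n)     ∎

  sumTo-*ˡ : ∀ n x (f : ℕ → Carrier) → sumTo n (λ k → x * f k) ≈ x * sumTo n f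
  sumTo-*ˡ zero x f = sym (zeroʳ x)
  sumTo-*ˡ (suc n) x f = trans (+-congʳ (sumTo-*ˡ n x f)) (sym (distribˡ x _ _))

  sumTo-linear : ∀ n (a x y : ℕ → Carrier) b →
    sumTo n (λ k → a k * (- (b * x k) + y k)) ≈ - (b * sumTo n (λ k → a k * x k)) + sumTo n (λ k → a k * y k)
  sumTo-linear n a x y b = begin
    sumTo n (λ k → a k * (- (b * x k) + y k))                      ≈⟨ sumTo-cong n (λ k _ → term k) ⟩
    sumTo n (λ k → - (b * (a k * x k)) + a k * y k)                ≈⟨ sumTo-+ n _ _ ⟩
    sumTo n (λ k → - (b * (a k * x k))) + sumTo n (λ k → a k * y k) ≈⟨ +-congʳ (sumTo-neg n _) ⟩
    - sumTo n (λ k → b * (a k * x k)) + sumTo n (λ k → a k * y k)   ≈⟨ +-congʳ (-‿cong (sumTo-*ˡ n b _)) ⟩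
    - (b * sumTo n (λ k → a k * x k)) + sumTo n (λ k → a k * y k)   ∎
    where
    term : ∀ k → a k * (- (b * x k) + y k) ≈ - (b * (a k * x k)) + a k * y k
    term k = begin
      a k * (- (b * x k) + y k)         ≈⟨ distribˡ _ _ _ ⟩
      a k * - (b * x k) + a k * y k     ≈⟨ +-congʳ (-‿distribʳ-* _ _) ⟨
      - (a k * (b * x k)) + a k * y k   ≈⟨ +-congʳ (-‿cong (x∙yz≈y∙xz _ _ _)) ⟩
      - (b * (a k * x k)) + a k * y k   ∎

  sumFin-cong : ∀ n {f g : Fin n → Carrier} → (∀ j → f j ≈ g j) → sumFin n f ≈ sumFin n g
  sumFin-cong zero eq = refl
  sumFin-cong (suc n) eq = +-cong (eq fzero) (sumFin-cong n (λ j → eq (fsuc j)))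

  sumFin-zero : ∀ n {f : Fin n → Carrier} → (∀ j → f j ≈ 0#) → sumFin n f ≈ 0#
  sumFin-zero zero eq = refl
  sumFin-zero (suc n) eq = trans (+-cong (eq fzero) (sumFin-zero n (λ j → eq (fsuc j)))) (+-identityˡ 0#)

  negPow-cong : ∀ k {x y} → x ≈ y → negPow k x ≈ negPow k y
  negPow-cong zero e = e
  negPow-cong (suc k) e = -‿cong (negPow-cong k e)

  negPow-+ : ∀ a b x → negPow (a N.+ b) x P.≡ negPow a (negPow b x)
  negPow-+ zero b x = P.refl
  negPow-+ (suc a) b x = P.cong -_ (negPow-+ a b x)

  negPow-twice : ∀ a x → negPow a (negPow a x) ≈ x
  negPow-twice a x = trans (≡⇒≈ (P.sym (negPow-+ a a x))) (even a)
    where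
    even : ∀ a → negPow (a N.+ a) x ≈ x
    even zero = refl
    even (suc a) = begin
      - negPow (a N.+ suc a) x   ≈⟨ -‿cong (≡⇒≈ (P.cong (λ t → negPow t x) (NP.+-suc a a))) ⟩
      - - negPow (a N.+ a) x     ≈⟨ -‿involutive _ ⟩
      negPow (a N.+ a) x         ≈⟨ even a ⟩
      x                          ∎

  negPow-*ˡ : ∀ k x y → negPow k (x * y) ≈ x * negPow k y
  negPow-*ˡ zero x y = refl
  negPow-*ˡ (suc k) x y = trans (-‿cong (negPow-*ˡ k x y)) (-‿distribʳ-* x _)

  negPow-zero : ∀ k → negPow k 0# ≈ 0#
  negPow-zero zero = refl
  negPow-zero (suc k) = trans (-‿cong (negPow-zero k)) -0#≈0#

  negPow-sumTo : ∀ k n (f : ℕ → Carrier) → negPow k (sumTo n f) ≈ sumTo n (λ j → negPow k (f j))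
  negPow-sumTo zero n f = refl
  negPow-sumTo (suc k) n f = trans (-‿cong (negPow-sumTo k n f)) (sym (sumTo-neg n _))

  alternating-reindex : ∀ n (c d : ℕ → Carrier) →
    negPow (suc n) (sumTo (suc n) (λ j → negPow j (c j * d (n ∸ j))))
      ≈ - sumTo (suc n) (λ k → c (n ∸ k) * negPow k (d k))
  alternating-reindex n c d = begin
    negPow (suc n) (sumTo (suc n) (λ j → negPow j (c j * d (n ∸ j))))
      ≈⟨ negPow-sumTo (suc n) (suc n) _ ⟩
    sumTo (suc n) (λ j → negPow (suc n) (negPow j (c j * d (n ∸ j))))
      ≈⟨ sumTo-cong (suc n) (λ j j<sn → -‿cong (term j (NP.≤-pred j<sn))) ⟩
    sumTo (suc n) (λ j → - g (n ∸ j))   ≈⟨ sumTo-neg (suc n) _ ⟩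
    - sumTo (suc n) (λ j → g (n ∸ j))   ≈⟨ -‿cong (sumTo-reverse (suc n) g) ⟨
    - sumTo (suc n) g                   ∎
    where
    g : ℕ → Carrier
    g k = c (n ∸ k) * negPow k (d k)
    -- (-1)^n (-1)^j = (-1)^{n-j} (-1)^j (-1)^j = (-1)^{n-j}
    term : ∀ j → j N.≤ n → negPow n (negPow j (c j * d (n ∸ j))) ≈ g (n ∸ j)
    term j j≤n = begin
      negPow n (negPow j X)                     ≈⟨ ≡⇒≈ (P.cong (λ t → negPow t (negPow j X)) (P.sym (NP.m∸n+n≡m j≤n))) ⟩
      negPow ((n ∸ j) N.+ j) (negPow j X)       ≈⟨ ≡⇒≈ (negPow-+ (n ∸ j) j _) ⟩
      negPow (n ∸ j) (negPow j (negPow j X))    ≈⟨ negPow-cong (n ∸ j) (negPow-twice j X) ⟩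
      negPow (n ∸ j) X                          ≈⟨ negPow-*ˡ (n ∸ j) _ _ ⟩
      c j * negPow (n ∸ j) (d (n ∸ j))          ≈⟨ *-congʳ (≡⇒≈ (P.cong c (P.sym (NP.m∸[m∸n]≡n j≤n)))) ⟩
      g (n ∸ j)                                 ∎
      where
      X = c j * d (n ∸ j)

  det-cong : ∀ n {M N : Matrix n} → (∀ i j → M i j ≈ N i j) → det n M ≈ det n N
  det-cong zero eq = refl
  det-cong (suc n) eq = sumFin-cong (suc n) (λ j → negPow-cong (toℕ j)
    (*-cong (eq fzero j) (det-cong n (λ i k → eq (fsuc i) (punchIn j k)))))

  ⟦_⟧ : (ℕ → ℕ → Carrier) → ∀ {n} → Matrix n
  ⟦ f ⟧ i j = f (toℕ i) (toℕ j)

  record IsUnitHessenberg (n : ℕ) (f : ℕ → ℕ → Carrier) : Set ℓ where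
    field
      superdiagonal : ∀ i → suc i N.< n → f i (suc i) ≈ 1#
      above         : ∀ i j → suc i N.< j → j N.< n → f i j ≈ 0#
  open IsUnitHessenberg

  shift : ℕ → (ℕ → ℕ → Carrier) → ℕ → ℕ → Carrier
  shift t f i k = f (t N.+ i) (t N.+ k)

  dropColumn₁ : (ℕ → ℕ → Carrier) → ℕ → ℕ → Carrier
  dropColumn₁ f i zero = f (suc i) 0
  dropColumn₁ f i (suc k) = f (suc i) (suc (suc k))

  dropColumn₁-hessenberg : ∀ n f → IsUnitHessenberg (suc n) f → IsUnitHessenberg n (dropColumn₁ f)
  dropColumn₁-hessenberg n f hf = record
    { superdiagonal = λ i p → superdiagonal hf (suc i) (s≤s p)
    ; above = zeros }
    where
    zeros : ∀ i j → suc i N.< j → j N.< n → dropColumn₁ f i j ≈ 0#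
    zeros i (suc j) p q = above hf (suc i) (suc (suc j)) (s≤s p) (s≤s q)

  -- Laplace along row 0: only the entries (0,0) and (0,1) = 1 survive.
  det-hessenberg-step : ∀ n f → IsUnitHessenberg (suc (suc n)) f →
    det (suc (suc n)) ⟦ f ⟧ ≈ f 0 0 * det (suc n) ⟦ shift 1 f ⟧ + - det (suc n) ⟦ dropColumn₁ f ⟧
  det-hessenberg-step n f hf = +-congˡ (trans (+-cong column₁ columns≥2) (+-identityʳ _))
    where
    column₁ : - (f 0 1 * det (suc n) (minor ⟦ f ⟧ (fsuc fzero))) ≈ - det (suc n) ⟦ dropColumn₁ f ⟧
    column₁ = -‿cong (trans (*-cong (superdiagonal hf 0 (s≤s (s≤s z≤n))) (det-cong (suc n) same))
                            (*-identityˡ _))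
      where
      same : ∀ i k → minor ⟦ f ⟧ (fsuc fzero) i k ≈ ⟦ dropColumn₁ f ⟧ i k
      same i fzero = refl
      same i (fsuc k) = refl
    columns≥2 : sumFin n (λ j → negPow (suc (suc (toℕ j)))
                  (f 0 (suc (suc (toℕ j))) * det (suc n) (minor ⟦ f ⟧ (fsuc (fsuc j))))) ≈ 0#
    columns≥2 = sumFin-zero n (λ j → trans (negPow-cong (suc (suc (toℕ j)))
      (trans (*-congʳ (above hf 0 _ (s≤s (s≤s z≤n)) (s≤s (s≤s (toℕ<n j))))) (zeroˡ _)))
      (negPow-zero (suc (suc (toℕ j)))))

  det-hessenberg-expansion : ∀ n f → IsUnitHessenberg (suc n) f →
    det (suc n) ⟦ f ⟧ ≈ sumTo (suc n) (λ j → negPow j (f j 0 * det (n ∸ j) ⟦ shift (suc j) f ⟧))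
  det-hessenberg-expansion zero f hf =
    trans (trans (+-identityʳ _) (*-identityʳ _)) (sym (trans (+-identityˡ _) (*-identityʳ _)))
  det-hessenberg-expansion (suc m) f hf = begin
    det (suc (suc m)) ⟦ f ⟧                               ≈⟨ det-hessenberg-step m f hf ⟩
    f 0 0 * det (suc m) ⟦ shift 1 f ⟧ + - det (suc m) ⟦ dropColumn₁ f ⟧
      ≈⟨ +-congˡ (-‿cong (det-hessenberg-expansion m (dropColumn₁ f) (dropColumn₁-hessenberg (suc m) f hf))) ⟩
    f 0 0 * det (suc m) ⟦ shift 1 f ⟧ + - sumTo (suc m) (λ j → negPow j (f (suc j) 0 * det (m ∸ j) ⟦ shift (suc (suc j)) f ⟧))
      ≈⟨ +-congˡ (sumTo-neg (suc m) _) ⟨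
    f 0 0 * det (suc m) ⟦ shift 1 f ⟧ + sumTo (suc m) (λ j → negPow (suc j) (f (suc j) 0 * det (m ∸ j) ⟦ shift (suc (suc j)) f ⟧))
      ≈⟨ sumTo-unfoldˡ (suc m) _ ⟨
    sumTo (suc (suc m)) (λ j → negPow j (f j 0 * det (suc m ∸ j) ⟦ shift (suc j) f ⟧)) ∎

  det-hessenberg-MCL : ∀ n f (F : ℕ → ℕ → ℕ → Carrier) → IsUnitHessenberg (suc n) f →
    (∀ j → j N.≤ n → ∀ x y → shift (suc j) f x y ≈ F (n ∸ j) x y) →
    negPow (suc n) (det (suc n) ⟦ f ⟧) ≈ - sumTo (suc n) (λ k → f (n ∸ k) 0 * negPow k (det k ⟦ F k ⟧))
  det-hessenberg-MCL n f F hf tails = begin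
    negPow (suc n) (det (suc n) ⟦ f ⟧)
      ≈⟨ negPow-cong (suc n) (det-hessenberg-expansion n f hf) ⟩
    negPow (suc n) (sumTo (suc n) (λ j → negPow j (f j 0 * det (n ∸ j) ⟦ shift (suc j) f ⟧)))
      ≈⟨ negPow-cong (suc n) (sumTo-cong (suc n) (λ j j<sn → negPow-cong j (*-congˡ
           (det-cong (n ∸ j) (λ x y → tails j (NP.≤-pred j<sn) (toℕ x) (toℕ y)))))) ⟩
    negPow (suc n) (sumTo (suc n) (λ j → negPow j (f j 0 * det (n ∸ j) ⟦ F (n ∸ j) ⟧)))
      ≈⟨ alternating-reindex n (λ j → f j 0) (λ k → det k ⟦ F k ⟧) ⟩
    - sumTo (suc n) (λ k → f (n ∸ k) 0 * negPow k (det k ⟦ F k ⟧)) ∎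

  -- Replacing column 0 by (H 1, H 2, …) keeps the Hessenberg shape and the trailing blocks.
  firstColumn : (ℕ → Carrier) → (ℕ → ℕ → Carrier) → ℕ → ℕ → Carrier
  firstColumn H f i zero = H (suc i)
  firstColumn H f i (suc k) = f i (suc k)

  firstColumn-hessenberg : ∀ n H f → IsUnitHessenberg n f → IsUnitHessenberg n (firstColumn H f)
  firstColumn-hessenberg n H f hf = record { superdiagonal = superdiagonal hf ; above = zeros }
    where
    zeros : ∀ i j → suc i N.< j → j N.< n → firstColumn H f i j ≈ 0#
    zeros i (suc j) p q = above hf i (suc j) p q

  det-firstColumn-MCL : ∀ n H f (F : ℕ → ℕ → ℕ → Carrier) → IsUnitHessenberg (suc n) f →
    (∀ j → j N.≤ n → ∀ x y → shift (suc j) f x y ≈ F (n ∸ j) x y) →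
    negPow (suc n) (det (suc n) ⟦ firstColumn H f ⟧) ≈ - sumTo (suc n) (λ k → H (suc n ∸ k) * negPow k (det k ⟦ F k ⟧))
  det-firstColumn-MCL n H f F hf tails =
    trans (det-hessenberg-MCL n (firstColumn H f) F (firstColumn-hessenberg (suc n) H f hf) tails)
          (-‿cong (sumTo-cong (suc n) (λ k k<sn →
            *-congʳ (≡⇒≈ (P.cong H (P.sym (suc-∸ (NP.≤-pred k<sn))))))))

  aEntry-below : ∀ h i k → k N.≤ i → aEntry h i k P.≡ h (suc (i ∸ k))
  aEntry-below h i k k≤i with k N.≤? i
  ... | yes _ = P.refl
  ... | no k≰i = ⊥-elim (k≰i k≤i)

  aEntry-superdiagonal : ∀ h i → aEntry h i (suc i) P.≡ 1#
  aEntry-superdiagonal h i with suc i N.≤? i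
  ... | yes p = ⊥-elim (NP.<-irrefl P.refl p)
  ... | no _ with suc i N.≟ suc i
  ...   | yes _ = P.refl
  ...   | no ne = ⊥-elim (ne P.refl)

  aEntry-above : ∀ h i k → suc i N.< k → aEntry h i k P.≡ 0#
  aEntry-above h i k q with k N.≤? i
  ... | yes p = ⊥-elim (NP.<⇒≱ q (NP.≤-trans p (NP.n≤1+n i)))
  ... | no _ with k N.≟ suc i
  ...   | yes e = ⊥-elim (NP.<-irrefl (P.sym e) q)
  ...   | no _ = P.refl

  aEntry-hessenberg : ∀ h n → IsUnitHessenberg n (aEntry h)
  aEntry-hessenberg h n = record
    { superdiagonal = λ i _ → ≡⇒≈ (aEntry-superdiagonal h i)
    ; above = λ i j p _ → ≡⇒≈ (aEntry-above h i j p) }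

  aEntry-suc : ∀ h i k → aEntry h (suc i) (suc k) P.≡ aEntry h i k
  aEntry-suc h i k with NP.<-cmp k (suc i)
  ... | tri< k<si _ _ = P.trans (aEntry-below h (suc i) (suc k) k<si) (P.sym (aEntry-below h i k (NP.≤-pred k<si)))
  ... | tri≈ _ P.refl _ = P.trans (aEntry-superdiagonal h (suc i)) (P.sym (aEntry-superdiagonal h i))
  ... | tri> _ _ si<k = P.trans (aEntry-above h (suc i) (suc k) (s≤s si<k)) (P.sym (aEntry-above h i k si<k))

  aEntry-shift : ∀ h t i k → shift t (aEntry h) i k P.≡ aEntry h i k
  aEntry-shift h zero i k = P.refl
  aEntry-shift h (suc t) i k = P.trans (aEntry-suc h (t N.+ i) (t N.+ k)) (aEntry-shift h t i k)

  -- First Ψ-recursion: the trailing blocks of the Ψ-matrix are Δ-matrices.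
  Ψ-closed : ∀ h H n → Ψ h H (suc n) ≈ - sumTo (suc n) (λ k → H (suc n ∸ k) * Δ h k)
  Ψ-closed h H n = trans (negPow-cong (suc n) (det-cong (suc n) same))
    (det-firstColumn-MCL n H (aEntry h) (λ _ → aEntry h) (aEntry-hessenberg h (suc n))
      (λ j _ x y → ≡⇒≈ (aEntry-shift h (suc j) x y)))
    where
    same : ∀ i j → ΨMat h H (suc n) i j ≈ ⟦ firstColumn H (aEntry h) ⟧ i j
    same i fzero = refl
    same i (fsuc j) = refl

  -- Δ is the special case H = h of Ψ, since a_{i1} = h_i.
  Δ≈Ψ : ∀ h s → Δ h s ≈ Ψ h h s
  Δ≈Ψ h s = negPow-cong s (det-cong s same)
    where
    same : ∀ i j → ΔMat h s i j ≈ ΨMat h h s i j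
    same i fzero = ≡⇒≈ (aEntry-below h (toℕ i) 0 z≤n)
    same i (fsuc j) = refl

  Δ-recursion : ∀ h n → Δ h (suc n) ≈ - sumTo (suc n) (λ k → h (suc n ∸ k) * Δ h k)
  Δ-recursion h n = trans (Δ≈Ψ h (suc n)) (Ψ-closed h h n)

  Ψ-one : ∀ h H → Ψ h H 1 ≈ - H 1
  Ψ-one h H = trans (Ψ-closed h H 0) (-‿cong (trans (+-identityˡ _) (*-identityʳ _)))

  Ψ-shift : ∀ h H k → Ψ h H (suc (suc k)) ≈ - (H 1 * Δ h (suc k)) + Ψ h (λ t → H (suc t)) (suc k)
  Ψ-shift h H k = begin
    Ψ h H (suc (suc k))                                  ≈⟨ Ψ-closed h H (suc k) ⟩
    - (A + H (suc (suc k) ∸ suc k) * Δ h (suc k))         ≈⟨ -‿+-comm _ _ ⟨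
    - A + - (H (suc (suc k) ∸ suc k) * Δ h (suc k))       ≈⟨ +-comm _ _ ⟩
    - (H (suc (suc k) ∸ suc k) * Δ h (suc k)) + - A
      ≈⟨ +-cong (-‿cong (*-congʳ (≡⇒≈ (P.cong H (NP.m+n∸n≡m 1 k))))) (-‿cong shifted) ⟩
    - (H 1 * Δ h (suc k)) + - sumTo (suc k) (λ i → H (suc (suc k ∸ i)) * Δ h i)
      ≈⟨ +-congˡ (Ψ-closed h (λ t → H (suc t)) k) ⟨
    - (H 1 * Δ h (suc k)) + Ψ h (λ t → H (suc t)) (suc k) ∎
    where
    A = sumTo (suc k) (λ i → H (suc (suc k) ∸ i) * Δ h i)
    shifted : A ≈ sumTo (suc k) (λ i → H (suc (suc k ∸ i)) * Δ h i)
    shifted = sumTo-cong (suc k) (λ i i<sk → *-congʳ (≡⇒≈ (P.cong H (suc-∸ (NP.<⇒≤ i<sk)))))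

  regroup : ∀ H₁ a T B U → - (H₁ * - (a + T)) + (- B + - U) ≈ - B + - (a * - H₁ + (- (H₁ * T) + U))
  regroup H₁ a T B U = begin
    - (H₁ * - (a + T)) + (- B + - U)     ≈⟨ +-congʳ lhs ⟩
    (H₁ * a + H₁ * T) + (- B + - U)      ≈⟨ +-comm _ _ ⟩
    (- B + - U) + (H₁ * a + H₁ * T)      ≈⟨ +-assoc _ _ _ ⟩
    - B + (- U + (H₁ * a + H₁ * T))      ≈⟨ +-congˡ (+-comm _ _) ⟩
    - B + ((H₁ * a + H₁ * T) + - U)      ≈⟨ +-congˡ (+-assoc _ _ _) ⟩
    - B + (H₁ * a + (H₁ * T + - U))      ≈⟨ +-congˡ rhs ⟨
    - B + - (a * - H₁ + (- (H₁ * T) + U)) ∎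
    where
    lhs : - (H₁ * - (a + T)) ≈ H₁ * a + H₁ * T
    lhs = trans (-‿cong (sym (-‿distribʳ-* H₁ _))) (trans (-‿involutive _) (distribˡ H₁ a T))
    rhs : - (a * - H₁ + (- (H₁ * T) + U)) ≈ H₁ * a + (H₁ * T + - U)
    rhs = trans (sym (-‿+-comm _ _))
      (+-cong (trans (-‿cong (sym (-‿distribʳ-* a H₁))) (trans (-‿involutive _) (*-comm a H₁)))
              (trans (sym (-‿+-comm _ _)) (+-congʳ (-‿involutive _))))

  Ψ-recursion : ∀ h H n → Ψ h H (suc n) ≈ - H (suc n) + - sumTo n (λ k → h (n ∸ k) * Ψ h H (suc k))
  Ψ-recursion h H zero = trans (Ψ-one h H) (sym (trans (+-congˡ -0#≈0#) (+-identityʳ _)))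
  Ψ-recursion h H (suc m) = begin
    Ψ h H (suc (suc m))                          ≈⟨ Ψ-shift h H m ⟩
    - (H₁ * Δ h (suc m)) + Ψ h σH (suc m)        ≈⟨ +-cong (-‿cong (*-congˡ Δ-split)) (Ψ-recursion h σH m) ⟩
    - (H₁ * - (a + T)) + (- B + - U)             ≈⟨ regroup H₁ a T B U ⟩
    - B + - (a * - H₁ + (- (H₁ * T) + U))        ≈⟨ +-congˡ (-‿cong (+-cong (*-congˡ (sym (Ψ-one h H))) (sym V-split))) ⟩
    - B + - (a * Ψ h H 1 + V)                    ≈⟨ +-congˡ (-‿cong (sumTo-unfoldˡ m _)) ⟨
    - B + - sumTo (suc m) (λ k → h (suc m ∸ k) * Ψ h H (suc k)) ∎
    where
    σH : ℕ → Carrier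
    σH t = H (suc t)
    H₁ = H 1
    a = h (suc m)
    B = H (suc (suc m))
    T = sumTo m (λ k → h (m ∸ k) * Δ h (suc k))
    U = sumTo m (λ k → h (m ∸ k) * Ψ h σH (suc k))
    V = sumTo m (λ k → h (m ∸ k) * Ψ h H (suc (suc k)))
    Δ-split : Δ h (suc m) ≈ - (a + T)
    Δ-split = trans (Δ-recursion h m) (-‿cong (trans (sumTo-unfoldˡ m _) (+-congʳ (*-identityʳ _))))
    V-split : V ≈ - (H₁ * T) + U
    V-split = trans (sumTo-cong m (λ k _ → *-congˡ (Ψ-shift h H k)))
                    (sumTo-linear m (λ k → h (m ∸ k)) (λ k → Δ h (suc k)) (λ k → Ψ h σH (suc k)) H₁)

  agree-upto : (D E : ℕ → Carrier) (s : ℕ) → D 0 ≈ E 0 →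
    (∀ m → suc m N.≤ s → (∀ k → k N.≤ m → D k ≈ E k) → D (suc m) ≈ E (suc m)) →
    ∀ m → m N.≤ s → D m ≈ E m
  agree-upto D E s d0 step m m≤s = below m m≤s m NP.≤-refl
    where
    below : ∀ m → m N.≤ s → ∀ k → k N.≤ m → D k ≈ E k
    below m _ zero _ = d0
    below (suc m) sm≤s (suc k) (s≤s k≤m) =
      step k (NP.≤-trans (s≤s k≤m) sm≤s)
        (λ i i≤k → below m (NP.≤-trans (NP.n≤1+n m) sm≤s) i (NP.≤-trans i≤k k≤m))

  Δ-unique : ∀ h (s : ℕ) (D : ℕ → Carrier) → D 0 ≈ 1# →
    ((m : ℕ) → 1 ≤ m → m ≤ s → D m ≈ - sumTo m (λ k → h (m ∸ k) * D k)) →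
    (m : ℕ) → m ≤ s → D m ≈ Δ h m
  Δ-unique h s D d0 rec = agree-upto D (Δ h) s d0 λ m sm≤s ih →
    trans (rec (suc m) (s≤s z≤n) sm≤s)
      (trans (-‿cong (sumTo-cong (suc m) (λ k k≤m → *-congˡ (ih k (NP.≤-pred k≤m))))) (sym (Δ-recursion h m)))

  Ψ-unique-closed : ∀ h H (s : ℕ) (P : ℕ → Carrier) → P 0 ≈ 1# →
    ((m : ℕ) → 1 ≤ m → m ≤ s → P m ≈ - sumTo m (λ k → H (m ∸ k) * Δ h k)) →
    (m : ℕ) → m ≤ s → P m ≈ Ψ h H m
  Ψ-unique-closed h H s P p0 closed zero _ = p0
  Ψ-unique-closed h H s P p0 closed (suc n) sn≤s = trans (closed (suc n) (s≤s z≤n) sn≤s) (sym (Ψ-closed h H n))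

  Ψ-unique-recursive : ∀ h H (s : ℕ) (P : ℕ → Carrier) → P 0 ≈ 1# →
    ((m : ℕ) → 1 ≤ m → m ≤ s → P m ≈ (- H m) + - sumTo (m ∸ 1) (λ k → h (m ∸ suc k) * P (suc k))) →
    (m : ℕ) → m ≤ s → P m ≈ Ψ h H m
  Ψ-unique-recursive h H s P p0 rec = agree-upto P (Ψ h H) s p0 λ m sm≤s ih →
    trans (rec (suc m) (s≤s z≤n) sm≤s)
      (trans (+-congˡ (-‿cong (sumTo-cong m (λ k k<m → *-congˡ (ih (suc k) k<m))))) (sym (Ψ-recursion h H m)))

  -- The two recursions for P are equivalent: both characterise Ψ(h,H) up to s.
  closed⇒recursive : ∀ h H (s : ℕ) (P : ℕ → Carrier) → P 0 ≈ 1# →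
    ((m : ℕ) → 1 ≤ m → m ≤ s → P m ≈ - sumTo m (λ k → H (m ∸ k) * Δ h k)) →
    (m : ℕ) → 1 ≤ m → m ≤ s → P m ≈ (- H m) + - sumTo (m ∸ 1) (λ k → h (m ∸ suc k) * P (suc k))
  closed⇒recursive h H s P p0 closed (suc n) _ sn≤s = begin
    P (suc n)                                                   ≈⟨ P≈Ψ sn≤s ⟩
    Ψ h H (suc n)                                               ≈⟨ Ψ-recursion h H n ⟩
    - H (suc n) + - sumTo n (λ k → h (n ∸ k) * Ψ h H (suc k))
      ≈⟨ +-congˡ (-‿cong (sumTo-cong n (λ k k<n → *-congˡ (sym (P≈Ψ (NP.≤-trans k<n (NP.≤-trans (NP.n≤1+n n) sn≤s))))))) ⟩
    - H (suc n) + - sumTo n (λ k → h (n ∸ k) * P (suc k))       ∎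
    where
    P≈Ψ : ∀ {m} → m ≤ s → P m ≈ Ψ h H m
    P≈Ψ = Ψ-unique-closed h H s P p0 closed _

  recursive⇒closed : ∀ h H (s : ℕ) (P : ℕ → Carrier) → P 0 ≈ 1# →
    ((m : ℕ) → 1 ≤ m → m ≤ s → P m ≈ (- H m) + - sumTo (m ∸ 1) (λ k → h (m ∸ suc k) * P (suc k))) →
    (m : ℕ) → 1 ≤ m → m ≤ s → P m ≈ - sumTo m (λ k → H (m ∸ k) * Δ h k)
  recursive⇒closed h H s P p0 rec (suc n) _ sn≤s =
    trans (Ψ-unique-recursive h H s P p0 rec (suc n) sn≤s) (Ψ-closed h H n)

  -- Λ, through the matrices Γ with G in the last row; the sequences h, G are fixed.
  module LastRow (h G : ℕ → Carrier) where

    -- The size-s MCL matrix of h whose last row (index s-1) is G_s, G_{s-1}, …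
    ΓEntry : ℕ → ℕ → ℕ → Carrier
    ΓEntry s i k with suc i N.≟ s
    ... | yes _ = G (s ∸ k)
    ... | no _ = aEntry h i k

    Γ : ℕ → Carrier
    Γ s = negPow s (det s ⟦ ΓEntry s ⟧)

    ΓEntry-last : ∀ s i k → suc i P.≡ s → ΓEntry s i k P.≡ G (s ∸ k)
    ΓEntry-last s i k e with suc i N.≟ s
    ... | yes _ = P.refl
    ... | no ne = ⊥-elim (ne e)

    ΓEntry-other : ∀ s i k → ¬ (suc i P.≡ s) → ΓEntry s i k P.≡ aEntry h i k
    ΓEntry-other s i k ne with suc i N.≟ s
    ... | yes e = ⊥-elim (ne e)
    ... | no _ = P.refl

    ΓEntry-hessenberg : ∀ s → IsUnitHessenberg s (ΓEntry s)
    ΓEntry-hessenberg s = record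
      { superdiagonal = λ i p → ≡⇒≈ (P.trans (ΓEntry-other s i (suc i) (λ e → NP.<-irrefl e p)) (aEntry-superdiagonal h i))
      ; above = λ i j p q → ≡⇒≈ (P.trans (ΓEntry-other s i j (λ e → NP.<-irrefl e (NP.<-trans p q))) (aEntry-above h i j p)) }

    ΓEntry-shift : ∀ t s i k → shift t (ΓEntry (t N.+ s)) i k P.≡ ΓEntry s i k
    ΓEntry-shift t s i k with suc i N.≟ s
    ... | yes e = P.trans (ΓEntry-last (t N.+ s) (t N.+ i) (t N.+ k) (P.trans (P.sym (NP.+-suc t i)) (P.cong (t N.+_) e)))
                          (P.cong G (NP.[m+n]∸[m+o]≡n∸o t s k))
    ... | no ne = P.trans (ΓEntry-other (t N.+ s) (t N.+ i) (t N.+ k)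
                            (λ e → ne (NP.+-cancelˡ-≡ t _ _ (P.trans (NP.+-suc t i) e))))
                          (aEntry-shift h t i k)

    ΓEntry-tails : ∀ n j → j N.≤ n → ∀ x y → shift (suc j) (ΓEntry (suc n)) x y ≈ ΓEntry (n ∸ j) x y
    ΓEntry-tails n j j≤n x y = ≡⇒≈ (P.trans
      (P.cong (λ s → shift (suc j) (ΓEntry s) x y) (P.cong suc (P.sym (NP.m+[n∸m]≡n j≤n))))
      (ΓEntry-shift (suc j) (n ∸ j) x y))

    -- Expanding Γ_{n+1}: the first column is h_n, …, h_1 above G_{n+1}.
    Γ-recursion : ∀ n → Γ (suc n) ≈ - G (suc n) + - sumTo n (λ k → h (n ∸ k) * Γ (suc k))
    Γ-recursion n = begin
      Γ (suc n)                ≈⟨ det-hessenberg-MCL n (ΓEntry (suc n)) ΓEntry (ΓEntry-hessenberg (suc n)) (ΓEntry-tails n) ⟩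
      - sumTo (suc n) (λ k → e₀ (n ∸ k) * Γ k)                     ≈⟨ -‿cong (sumTo-unfoldˡ n _) ⟩
      - (e₀ n * 1# + sumTo n (λ k → e₀ (n ∸ suc k) * Γ (suc k)))
        ≈⟨ -‿cong (+-cong (trans (*-identityʳ _) (≡⇒≈ (ΓEntry-last (suc n) n 0 P.refl)))
                          (sumTo-cong n (λ k k<n → *-congʳ (≡⇒≈ (column k k<n))))) ⟩
      - (G (suc n) + sumTo n (λ k → h (n ∸ k) * Γ (suc k)))        ≈⟨ -‿+-comm _ _ ⟨
      - G (suc n) + - sumTo n (λ k → h (n ∸ k) * Γ (suc k))        ∎
      where
      e₀ : ℕ → Carrier
      e₀ i = ΓEntry (suc n) i 0
      column : ∀ k → k N.< n → e₀ (n ∸ suc k) P.≡ h (n ∸ k)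
      column k k<n = P.trans (ΓEntry-other (suc n) (n ∸ suc k) 0 not-last)
                       (P.trans (aEntry-below h (n ∸ suc k) 0 z≤n) (P.cong h index))
        where
        index : suc (n ∸ suc k) P.≡ n ∸ k
        index = P.sym (suc-∸ k<n)
        not-last : ¬ (suc (n ∸ suc k) P.≡ suc n)
        not-last e = NP.<-irrefl (P.trans (P.sym index) e) (s≤s (NP.m∸n≤m n k))

    -- Γ solves the second Ψ-recursion for G, so Γ_m = Ψ_m(h,G).
    Γ≈Ψ : ∀ m → Γ m ≈ Ψ h G m
    Γ≈Ψ m = Ψ-unique-recursive h G m Γ refl (λ { (suc n) _ _ → Γ-recursion n }) m NP.≤-refl

    -- The Λ-matrix is the Γ-matrix with first column H, so its trailing blocks are Γ-matrices.
    Λ-closed : ∀ H n → Λ h H G (suc n) ≈ - sumTo (suc n) (λ k → H (suc n ∸ k) * Ψ h G k)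
    Λ-closed H n = begin
      Λ h H G (suc n)      ≈⟨ negPow-cong (suc n) (det-cong (suc n) same) ⟩
      negPow (suc n) (det (suc n) ⟦ firstColumn H (ΓEntry (suc n)) ⟧)
        ≈⟨ det-firstColumn-MCL n H (ΓEntry (suc n)) ΓEntry (ΓEntry-hessenberg (suc n)) (ΓEntry-tails n) ⟩
      - sumTo (suc n) (λ k → H (suc n ∸ k) * Γ k)     ≈⟨ -‿cong (sumTo-cong (suc n) (λ k _ → *-congˡ (Γ≈Ψ k))) ⟩
      - sumTo (suc n) (λ k → H (suc n ∸ k) * Ψ h G k) ∎
      where
      same : ∀ i j → ΛMat h H G (suc n) i j ≈ ⟦ firstColumn H (ΓEntry (suc n)) ⟧ i j
      same i fzero = refl
      same i (fsuc j) with suc (toℕ i) N.≟ suc n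
      ... | yes _ = refl
      ... | no _ = refl

    Λ-unique : ∀ H (s : ℕ) (L : ℕ → Carrier) → L 0 ≈ 1# →
      ((m : ℕ) → 1 ≤ m → m ≤ s → L m ≈ - sumTo m (λ k → H (m ∸ k) * Ψ h G k)) →
      (m : ℕ) → m ≤ s → L m ≈ Λ h H G m
    Λ-unique H s L l0 closed zero _ = l0
    Λ-unique H s L l0 closed (suc n) sn≤s = trans (closed (suc n) (s≤s z≤n) sn≤s) (sym (Λ-closed H n))

lemma3p1 : ∀ {c ℓ} (R : CommutativeRing c ℓ) → let open CommutativeRing R in let open MCL R in
    (h H G : ℕ → Carrier) →
    ((s : ℕ) → 1 ≤ s → Δ h s ≈ - sumTo s (λ k → h (s ∸ k) * Δ h k))
    × ((s : ℕ) → 1 ≤ s → Ψ h H s ≈ - sumTo s (λ k → H (s ∸ k) * Δ h k))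
    × ((s : ℕ) → 1 ≤ s → Ψ h H s ≈ (- H s) + - sumTo (s ∸ 1) (λ k → h (s ∸ suc k) * Ψ h H (suc k)))
    × ((s : ℕ) → 1 ≤ s → Λ h H G s ≈ - sumTo s (λ k → H (s ∸ k) * Ψ h G k))
    × ((s : ℕ) (D : ℕ → Carrier) → D 0 ≈ 1# →
    ((m : ℕ) → 1 ≤ m → m ≤ s → D m ≈ - sumTo m (λ k → h (m ∸ k) * D k)) →
    (m : ℕ) → m ≤ s → D m ≈ Δ h m)
    × ((s : ℕ) (P : ℕ → Carrier) → P 0 ≈ 1# →
    ((m : ℕ) → 1 ≤ m → m ≤ s → P m ≈ - sumTo m (λ k → H (m ∸ k) * Δ h k)) →
    (m : ℕ) → 1 ≤ m → m ≤ s → P m ≈ (- H m) + - sumTo (m ∸ 1) (λ k → h (m ∸ suc k) * P (suc k)))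
    × ((s : ℕ) (P : ℕ → Carrier) → P 0 ≈ 1# →
    ((m : ℕ) → 1 ≤ m → m ≤ s → P m ≈ (- H m) + - sumTo (m ∸ 1) (λ k → h (m ∸ suc k) * P (suc k))) →
    (m : ℕ) → 1 ≤ m → m ≤ s → P m ≈ - sumTo m (λ k → H (m ∸ k) * Δ h k))
    × ((s : ℕ) (P : ℕ → Carrier) → P 0 ≈ 1# →
    ((m : ℕ) → 1 ≤ m → m ≤ s → P m ≈ - sumTo m (λ k → H (m ∸ k) * Δ h k)) →
    (m : ℕ) → m ≤ s → P m ≈ Ψ h H m)
    × ((s : ℕ) (P : ℕ → Carrier) → P 0 ≈ 1# →
    ((m : ℕ) → 1 ≤ m → m ≤ s → P m ≈ (- H m) + - sumTo (m ∸ 1) (λ k → h (m ∸ suc k) * P (suc k))) →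
    (m : ℕ) → m ≤ s → P m ≈ Ψ h H m)
    × ((s : ℕ) (L : ℕ → Carrier) → L 0 ≈ 1# →
    ((m : ℕ) → 1 ≤ m → m ≤ s → L m ≈ - sumTo m (λ k → H (m ∸ k) * Ψ h G k)) →
    (m : ℕ) → m ≤ s → L m ≈ Λ h H G m)
lemma3p1 R h H G =
    (λ { (suc n) _ → Δ-recursion h n })
  , (λ { (suc n) _ → Ψ-closed h H n })
  , (λ { (suc n) _ → Ψ-recursion h H n })
  , (λ { (suc n) _ → Λ-closed H n })
  , Δ-unique h
  , closed⇒recursive h H
  , recursive⇒closed h H
  , Ψ-unique-closed h H
  , Ψ-unique-recursive h H
  , Λ-unique H
  where
  open MCLRecursions R
  open LastRow h G
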